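{- Let $p\geq 2$ and let $G$ be a $K_{1,p+1}$-free $2p$-regular graph. Let $\vec{G}$ be an orientation of $G$ that admits an out-neighbourhood bijective homomorphism $\psi$ to $\vec{L}(K_{p+2})$. Then $\psi$ is a locally bijective homomorphism from $\vec{G}$ to $\vec{L}(K_{p+2})$. In particular, $\psi$ is a locally bijective homomorphism from $G$ to $L^*(K_{p+2})$.
   Context: $K_{1,p+1}$-free means no induced subgraph isomorphic to $K_{1,p+1}$. $\vec{L}(K_{p+2})$ is the oriented graph whose vertices are the ordered pairs $(i,j)$ of distinct elements of $\mathbb{Z}_{p+2}$, with an arc from $(i,j)$ to $(j,k)$ whenever $k\neq i$; $L^*(K_{p+2})$ is its underlying undirected graph. An out-neighbourhood bijective homomorphism from $\vec{G}$ to $\vec{H}$ is a map $\psi$ such that for every $v$ the restriction of $\psi$ to $N^+_{\vec{G}}(v)$ is a bijection onto $N^+_{\vec{H}}(\psi(v))$. A locally bijective homomorphism between oriented graphs is a map that, for every vertex $v$, maps the in-neighbours of $v$ bijectively onto the in-neighbours of $\psi(v)$ and the out-neighbours of $v$ bijectively onto the out-neighbours of $\psi(v)$. A locally bijective homomorphism between undirected graphs $G\to H$ is a map whose restriction to each $N_G(v)$ is a bijection onto $N_H(\psi(v))$. -}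

module Defs where

open import Data.Nat using (ℕ; suc; _+_; _*_)
open import Data.Fin using (Fin; _≟_)
open import Data.Bool using (Bool; T; not; _∧_; _∨_)
open import Data.Product using (Σ; _×_; _,_; ∃; proj₁; proj₂)
open import Data.Sum using (_⊎_)
open import Relation.Nullary using (¬_; ⌊_⌋)
open import Relation.Binary.PropositionalEquality using (_≡_; _≢_)
open import Function.Bundles using (_↔_)

record Graph (n : ℕ) : Set where
  field
    adj   : Fin n → Fin n → Bool
    sym   : ∀ u v → T (adj u v) → T (adj v u)
    irref : ∀ v → ¬ T (adj v v)
open Graph public

N : ∀ {n} → Graph n → Fin n → Set
N G v = Σ (Fin _) λ u → T (adj G v u)

Regular : ∀ {n} → ℕ → Graph n → Set
Regular d G = ∀ v → N G v ↔ Fin d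

K1-Free : ∀ {n} → ℕ → Graph n → Set
K1-Free {n} q G =
  ¬ (Σ (Fin n) λ v → Σ (Fin q → Fin n) λ f →
       (∀ i j → f i ≡ f j → i ≡ j) ×
       (∀ i → T (adj G v (f i))) ×
       (∀ i j → i ≢ j → ¬ T (adj G (f i) (f j))))

record Orientation {n} (G : Graph n) : Set where
  field
    arc      : Fin n → Fin n → Bool
    arc⇒adj  : ∀ u v → T (arc u v) → T (adj G u v)
    adj⇒arc  : ∀ u v → T (adj G u v) → T (arc u v) ⊎ T (arc v u)
    antisym  : ∀ u v → T (arc u v) → ¬ T (arc v u)
open Orientation public

-- The oriented line graph L⃗(K_{p+2}).
-- Vertices: ordered pairs (i , j) of distinct elements of Fin (p+2).
LV : ℕ → Set
LV p = Σ (Fin (suc (suc p)) × Fin (suc (suc p))) λ ij →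
         T (not ⌊ proj₁ ij ≟ proj₂ ij ⌋)

LArc : (p : ℕ) → LV p → LV p → Bool
LArc p ((i , j) , _) ((j' , k) , _) = ⌊ j ≟ j' ⌋ ∧ not ⌊ k ≟ i ⌋

-- Underlying undirected adjacency of L⃗(K_{p+2}), i.e. L*(K_{p+2}).
LAdj : (p : ℕ) → LV p → LV p → Bool
LAdj p x y = LArc p x y ∨ LArc p y x

NbhdBij : {A B : Set} → (A → A → Bool) → (B → B → Bool) → (A → B) → A → Set
NbhdBij {A} {B} R S ψ v =
  (∀ u → T (R v u) → T (S (ψ v) (ψ u))) ×
  (∀ u w → T (R v u) → T (R v w) → ψ u ≡ ψ w → u ≡ w) ×
  (∀ y → T (S (ψ v) y) → Σ A λ u → T (R v u) × ψ u ≡ y)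

flip′ : {A : Set} → (A → A → Bool) → A → A → Bool
flip′ R x y = R y x

OutNbhdBijective : {A B : Set} → (A → A → Bool) → (B → B → Bool) → (A → B) → Set
OutNbhdBijective R S ψ = ∀ v → NbhdBij R S ψ v

LocBijOriented : {A B : Set} → (A → A → Bool) → (B → B → Bool) → (A → B) → Set
LocBijOriented R S ψ = ∀ v → NbhdBij (flip′ R) (flip′ S) ψ v × NbhdBij R S ψ v

LocBijUndirected : {A B : Set} → (A → A → Bool) → (B → B → Bool) → (A → B) → Set
LocBijUndirected R S ψ = ∀ v → NbhdBij R S ψ v

{-# OPTIONS --safe #-}
module Submission where

open import Defs hiding (sym)
open Defs using () renaming (sym to adj-sym)
open import Data.Nat using (ℕ; suc; _≤_; _*_; _+_)
open import Data.Nat.Properties using (+-comm; n<1+n)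
open import Data.Fin using (Fin; zero; suc; _≟_; punchIn; punchOut; cast)
open import Data.Fin.Properties
  using ( punchIn-injective; punchInᵢ≢i; punchIn-punchOut; punchOut-injective
        ; any?; <⇒notInjective; *↔×; cast-involutive)
open import Data.Vec.Functional using (_∷_)
open import Data.Bool using (T)
open import Data.Bool.Properties using (T-∧; T-∨; T-irrelevant; T?)
open import Data.Product using (Σ; _×_; _,_; ∃; proj₁; proj₂)
open import Data.Sum using (_⊎_; inj₁; inj₂)
open import Data.Empty using (⊥-elim)
open import Function using (_∘_)
open import Function.Bundles using (_↔_; Equivalence; Injection; Inverse)
open import Function.Definitions using (Injective)
open import Function.Properties.Inverse using (↔⇒↣; ↔-sym)
open import Relation.Nullary using (¬_; ⌊_⌋; yes; no; contradiction)
open import Relation.Nullary.Decidable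
  using (toWitness; fromWitness; toWitnessFalse; fromWitnessFalse)
open import Relation.Binary.PropositionalEquality using (_≡_; _≢_; refl; sym; trans; cong)

-- Let ψ v = (i , j).  Out-bijectivity puts the p out-neighbours of v onto the
-- vertices (j , k) with k ∉ {i , j}; no arc of L⃗(K_{p+2}) joins two of them,
-- so they are pairwise non-adjacent.  If u → v then ψ u = (h , i), and for the
-- out-neighbour w with ψ w = (j , h) the vertex u must be adjacent to w, since
-- otherwise u and the out-neighbours of v form an induced K_{1,p+1}; as
-- u → v → w cannot close a directed triangle in L⃗(K_{p+2}), the edge is w → u.
-- Hence two in-neighbours of v with the same image are both out-neighbours of
-- the same w, which makes ψ injective on in-neighbourhoods.  Finally v has 2p
-- neighbours, injectively coded by Fin 2 × Fin p, so the code is onto, and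
-- every (h , i) is hit by an in-neighbour.

Fin-injective⇒surjective : ∀ {m} (f : Fin m → Fin m) → Injective _≡_ _≡_ f →
                           ∀ y → ∃ λ x → f x ≡ y
Fin-injective⇒surjective {suc m} f f-injective y with any? (λ x → f x ≟ y)
... | yes hit = hit
... | no miss = ⊥-elim (<⇒notInjective {f = punched} (n<1+n m) punched-injective)
  where
    y≢f : ∀ x → y ≢ f x
    y≢f x e = miss (x , sym e)

    punched : Fin (suc m) → Fin m
    punched x = punchOut (y≢f x)

    punched-injective : Injective _≡_ _≡_ punched
    punched-injective {x} {x′} = f-injective ∘ punchOut-injective (y≢f x) (y≢f x′)

injective⇒surjective : ∀ {m} {A B : Set} → A ↔ Fin m → B ↔ Fin m →
                       (f : A → B) → Injective _≡_ _≡_ f → ∀ y → ∃ λ x → f x ≡ y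
injective⇒surjective A↔ B↔ f f-injective y =
  from A↔ x , injective B↔ gx≡y
  where
    open Inverse using (to; from)

    injective : ∀ {C D : Set} (C↔ : C ↔ D) → Injective _≡_ _≡_ (to C↔)
    injective C↔ = Injection.injective (↔⇒↣ C↔)

    g : Fin _ → Fin _
    g = to B↔ ∘ f ∘ from A↔

    hit : ∃ λ x → g x ≡ to B↔ y
    hit = Fin-injective⇒surjective g
            (injective (↔-sym A↔) ∘ f-injective ∘ injective B↔) (to B↔ y)

    x = proj₁ hit
    gx≡y = proj₂ hit

cast-injective : ∀ {m n} (e : m ≡ n) → Injective _≡_ _≡_ (cast e)
cast-injective e {x} {y} cx≡cy =
  trans (sym (cast-involutive (sym e) e x))
        (trans (cong (cast (sym e)) cx≡cy) (cast-involutive (sym e) e y))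

module Punch₂ {m : ℕ} {a b : Fin (suc (suc m))} (a≢b : a ≢ b) where

  b′ : Fin (suc m)
  b′ = punchOut a≢b

  punchIn₂ : Fin m → Fin (suc (suc m))
  punchIn₂ k = punchIn a (punchIn b′ k)

  punchIn₂≢a : ∀ k → punchIn₂ k ≢ a
  punchIn₂≢a k = punchInᵢ≢i a (punchIn b′ k)

  punchIn₂≢b : ∀ k → punchIn₂ k ≢ b
  punchIn₂≢b k e =
    punchInᵢ≢i b′ k (punchIn-injective a _ _ (trans e (sym (punchIn-punchOut a≢b))))

  punchIn₂-injective : Injective _≡_ _≡_ punchIn₂
  punchIn₂-injective = punchIn-injective b′ _ _ ∘ punchIn-injective a _ _

  b′≢ : ∀ {x} (x-fresh : x ≢ a × x ≢ b) → b′ ≢ punchOut (proj₁ x-fresh ∘ sym)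
  b′≢ (x≢a , x≢b) = x≢b ∘ sym ∘ punchOut-injective a≢b (x≢a ∘ sym)

  punchOut₂ : ∀ {x} → x ≢ a × x ≢ b → Fin m
  punchOut₂ x-fresh = punchOut (b′≢ x-fresh)

  punchOut₂-injective : ∀ {x y} (x-fresh : x ≢ a × x ≢ b) (y-fresh : y ≢ a × y ≢ b) →
                        punchOut₂ x-fresh ≡ punchOut₂ y-fresh → x ≡ y
  punchOut₂-injective x-fresh y-fresh =
    punchOut-injective (proj₁ x-fresh ∘ sym) (proj₁ y-fresh ∘ sym) ∘
    punchOut-injective (b′≢ x-fresh) (b′≢ y-fresh)

module _ {p : ℕ} where

  src dst : LV p → Fin (suc (suc p))
  src ((a , _) , _) = a
  dst ((_ , b) , _) = b

  src≢dst : (x : LV p) → src x ≢ dst x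
  src≢dst ((a , b) , a≢b) = toWitnessFalse {a? = a ≟ b} a≢b

  edge : (a b : Fin (suc (suc p))) → a ≢ b → LV p
  edge a b a≢b = (a , b) , fromWitnessFalse {a? = a ≟ b} a≢b

  LV-≡ : ∀ {x y : LV p} → src x ≡ src y → dst x ≡ dst y → x ≡ y
  LV-≡ {(a , b) , t} {(_ , _) , t′} refl refl = cong ((a , b) ,_) (T-irrelevant t t′)

  LArc⇒ : ∀ x y → T (LArc p x y) → dst x ≡ src y × dst y ≢ src x
  LArc⇒ ((a , b) , _) ((c , d) , _) xy
    with b≡c , d≢a ← Equivalence.to (T-∧ {⌊ b ≟ c ⌋}) xy =
    toWitness {a? = b ≟ c} b≡c , toWitnessFalse {a? = d ≟ a} d≢a

  LArc⇐ : ∀ x y → dst x ≡ src y → dst y ≢ src x → T (LArc p x y)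
  LArc⇐ ((a , b) , _) ((c , d) , _) b≡c d≢a =
    Equivalence.from T-∧ (fromWitness {a? = b ≟ c} b≡c , fromWitnessFalse {a? = d ≟ a} d≢a)

  LArc-src-fresh : ∀ x y → T (LArc p x y) → src x ≢ src y × src x ≢ dst y
  LArc-src-fresh x y xy with dx≡sy , dy≢sx ← LArc⇒ x y xy =
    (λ e → src≢dst x (trans e (sym dx≡sy))) , dy≢sx ∘ sym

  LArc-dst-fresh : ∀ x y → T (LArc p x y) → dst y ≢ src x × dst y ≢ dst x
  LArc-dst-fresh x y xy with dx≡sy , dy≢sx ← LArc⇒ x y xy =
    dy≢sx , λ e → src≢dst y (trans (sym dx≡sy) (sym e))

  LArc-asym : ∀ x y → T (LArc p x y) → ¬ T (LArc p y x)
  LArc-asym x y xy yx = proj₂ (LArc⇒ y x yx) (proj₁ (LArc⇒ x y xy))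

  LArc-no-transitive-triangle : ∀ x y z → T (LArc p x y) → T (LArc p y z) → ¬ T (LArc p x z)
  LArc-no-transitive-triangle x y z xy yz xz =
    src≢dst y (trans (sym (proj₁ (LArc⇒ x y xy)))
                     (trans (proj₁ (LArc⇒ x z xz)) (sym (proj₁ (LArc⇒ y z yz)))))

  LArc-out-independent : ∀ v x y → T (LArc p v x) → T (LArc p v y) → ¬ T (LArc p x y)
  LArc-out-independent v x y vx vy xy =
    src≢dst x (trans (sym (proj₁ (LArc⇒ v x vx)))
                     (trans (proj₁ (LArc⇒ v y vy)) (sym (proj₁ (LArc⇒ x y xy)))))

IsInducedStar : ∀ {n q} → Graph n → Fin n → (Fin q → Fin n) → Set
IsInducedStar G v f =
  (∀ i j → f i ≡ f j → i ≡ j) ×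
  (∀ i → T (adj G v (f i))) ×
  (∀ i j → i ≢ j → ¬ T (adj G (f i) (f j)))

module _ {n : ℕ} (G : Graph n) (v : Fin n) where

  IsInducedStar-reindex : ∀ {q r} {f : Fin q → Fin n} (g : Fin r → Fin q) →
                          Injective _≡_ _≡_ g → IsInducedStar G v f →
                          IsInducedStar G v (f ∘ g)
  IsInducedStar-reindex g g-injective (f-injective , v~f , f≁f) =
    (λ i j → g-injective ∘ f-injective (g i) (g j)) ,
    v~f ∘ g ,
    (λ i j i≢j → f≁f (g i) (g j) (i≢j ∘ g-injective))

  IsInducedStar-∷ : ∀ {q u} {f : Fin q → Fin n} → IsInducedStar G v f →
                    T (adj G v u) → (∀ k → u ≢ f k) → (∀ k → ¬ T (adj G u (f k))) →
                    IsInducedStar G v (u ∷ f)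
  IsInducedStar-∷ {u = u} {f} (f-injective , v~f , f≁f) v~u u≢f u≁f =
    injective , adjacent , independent
    where
      injective : ∀ i j → (u ∷ f) i ≡ (u ∷ f) j → i ≡ j
      injective zero    zero    _ = refl
      injective zero    (suc l) e = contradiction e (u≢f l)
      injective (suc k) zero    e = contradiction (sym e) (u≢f k)
      injective (suc k) (suc l) e = cong suc (f-injective k l e)

      adjacent : ∀ i → T (adj G v ((u ∷ f) i))
      adjacent zero    = v~u
      adjacent (suc k) = v~f k

      independent : ∀ i j → i ≢ j → ¬ T (adj G ((u ∷ f) i) ((u ∷ f) j))
      independent zero    zero    i≢j = contradiction refl i≢j
      independent zero    (suc l) _   = u≁f l
      independent (suc k) zero    _   = u≁f k ∘ adj-sym G _ _
      independent (suc k) (suc l) k≢l = f≁f k l (k≢l ∘ cong suc)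

  K1-Free⇒no-induced-star : ∀ {q} → K1-Free (q + 1) G →
                            (f : Fin (suc q) → Fin n) → ¬ IsInducedStar G v f
  K1-Free⇒no-induced-star {q} free f star =
    free (v , f ∘ cast eq , IsInducedStar-reindex {f = f} (cast eq) (cast-injective eq) star)
    where
      eq : q + 1 ≡ suc q
      eq = +-comm q 1

module LocallyBijective
  (p n : ℕ) (G : Graph n) (free : K1-Free (p + 1) G) (regular : Regular (2 * p) G)
  (O : Orientation G) (ψ : Fin n → LV p) (ψ-out : OutNbhdBijective (arc O) (LArc p) ψ)
  where

  infix 4 _⇾_
  _⇾_ : Fin n → Fin n → Set
  u ⇾ w = T (arc O u w)

  hom : ∀ {u w} → u ⇾ w → T (LArc p (ψ u) (ψ w))
  hom {u} {w} = proj₁ (ψ-out u) w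

  out-injective : ∀ {v u w} → v ⇾ u → v ⇾ w → ψ u ≡ ψ w → u ≡ w
  out-injective {v} {u} {w} = proj₁ (proj₂ (ψ-out v)) u w

  out-surjective : ∀ {v} y → T (LArc p (ψ v) y) → Σ (Fin n) λ u → v ⇾ u × ψ u ≡ y
  out-surjective {v} = proj₂ (proj₂ (ψ-out v))

  ⇾⇒dst≡src : ∀ {u w} → u ⇾ w → dst (ψ u) ≡ src (ψ w)
  ⇾⇒dst≡src {u} {w} = proj₁ ∘ LArc⇒ (ψ u) (ψ w) ∘ hom

  ⇾-no-transitive-triangle : ∀ {u v w} → u ⇾ v → v ⇾ w → ¬ u ⇾ w
  ⇾-no-transitive-triangle {u} {v} {w} uv vw uw =
    LArc-no-transitive-triangle (ψ u) (ψ v) (ψ w) (hom uv) (hom vw) (hom uw)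

  out-independent : ∀ {v x y} → v ⇾ x → v ⇾ y → ¬ T (adj G x y)
  out-independent {v} {x} {y} vx vy x~y with adj⇒arc O x y x~y
  ... | inj₁ xy = LArc-out-independent (ψ v) (ψ x) (ψ y) (hom vx) (hom vy) (hom xy)
  ... | inj₂ yx = LArc-out-independent (ψ v) (ψ y) (ψ x) (hom vy) (hom vx) (hom yx)

  out-determined-by-dst : ∀ {v x y} → v ⇾ x → v ⇾ y → dst (ψ x) ≡ dst (ψ y) → x ≡ y
  out-determined-by-dst vx vy dx≡dy =
    out-injective vx vy (LV-≡ (trans (sym (⇾⇒dst≡src vx)) (⇾⇒dst≡src vy)) dx≡dy)

  module AtVertex (v : Fin n) where

    i j : Fin (suc (suc p))
    i = src (ψ v)
    j = dst (ψ v)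

    open Punch₂ (src≢dst (ψ v))

    out-fresh : ∀ {w} → v ⇾ w → dst (ψ w) ≢ i × dst (ψ w) ≢ j
    out-fresh {w} = LArc-dst-fresh (ψ v) (ψ w) ∘ hom

    in-fresh : ∀ {u} → u ⇾ v → src (ψ u) ≢ i × src (ψ u) ≢ j
    in-fresh {u} = LArc-src-fresh (ψ u) (ψ v) ∘ hom

    out-neighbour-towards : ∀ h → h ≢ i → h ≢ j → Σ (Fin n) λ w → v ⇾ w × dst (ψ w) ≡ h
    out-neighbour-towards h h≢i h≢j
      with w , vw , ψw≡jh ← out-surjective (edge j h (h≢j ∘ sym))
                              (LArc⇐ (ψ v) (edge j h (h≢j ∘ sym)) refl h≢i)
      = w , vw , cong dst ψw≡jh

    out-neighbour-towards-punchIn₂ : ∀ k → Σ (Fin n) λ w → v ⇾ w × dst (ψ w) ≡ punchIn₂ k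
    out-neighbour-towards-punchIn₂ k = out-neighbour-towards (punchIn₂ k) (punchIn₂≢a k) (punchIn₂≢b k)

    out-neighbour : Fin p → Fin n
    out-neighbour = proj₁ ∘ out-neighbour-towards-punchIn₂

    ⇾out-neighbour : ∀ k → v ⇾ out-neighbour k
    ⇾out-neighbour = proj₁ ∘ proj₂ ∘ out-neighbour-towards-punchIn₂

    dst-out-neighbour : ∀ k → dst (ψ (out-neighbour k)) ≡ punchIn₂ k
    dst-out-neighbour = proj₂ ∘ proj₂ ∘ out-neighbour-towards-punchIn₂

    out-neighbours-star : IsInducedStar G v out-neighbour
    out-neighbours-star =
      (λ k l e → punchIn₂-injective (trans (sym (dst-out-neighbour k))
                                           (trans (cong (dst ∘ ψ) e) (dst-out-neighbour l)))) ,
      (λ k → arc⇒adj O _ _ (⇾out-neighbour k)) ,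
      (λ k l _ → out-independent (⇾out-neighbour k) (⇾out-neighbour l))

    closing-arc : ∀ {u w} → u ⇾ v → v ⇾ w → dst (ψ w) ≡ src (ψ u) → w ⇾ u
    closing-arc {u} {w} uv vw dw≡su with T? (adj G u w)
    ... | yes u~w with adj⇒arc O u w u~w
    ...   | inj₁ uw = contradiction uw (⇾-no-transitive-triangle uv vw)
    ...   | inj₂ wu = wu
    closing-arc {u} {w} uv vw dw≡su | no u≁w =
      ⊥-elim (K1-Free⇒no-induced-star G v free (u ∷ out-neighbour)
        (IsInducedStar-∷ G v out-neighbours-star v~u u≢out u≁out))
      where
        v~u : T (adj G v u)
        v~u = adj-sym G u v (arc⇒adj O u v uv)

        u≢out : ∀ k → u ≢ out-neighbour k
        u≢out k refl = antisym O u v uv (⇾out-neighbour k)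

        u≁out : ∀ k → ¬ T (adj G u (out-neighbour k))
        u≁out k u~w′ with adj⇒arc O _ _ u~w′
        ... | inj₁ uw′ = ⇾-no-transitive-triangle uv (⇾out-neighbour k) uw′
        ... | inj₂ w′u = u≁w (subst-w (out-determined-by-dst (⇾out-neighbour k) vw
                                         (trans (⇾⇒dst≡src w′u) (sym dw≡su))))
          where
            subst-w : out-neighbour k ≡ w → T (adj G u w)
            subst-w refl = u~w′

    in-determined-by-src : ∀ {u u′} → u ⇾ v → u′ ⇾ v → src (ψ u) ≡ src (ψ u′) → u ≡ u′
    in-determined-by-src {u} {u′} uv u′v su≡su′
      with su≢i , su≢j ← in-fresh uv
      with w , vw , dw≡su ← out-neighbour-towards (src (ψ u)) su≢i su≢j
      = out-injective (closing-arc uv vw dw≡su) (closing-arc u′v vw (trans dw≡su su≡su′))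
          (LV-≡ su≡su′ (trans (⇾⇒dst≡src uv) (sym (⇾⇒dst≡src u′v))))

    in-injective : ∀ u u′ → u ⇾ v → u′ ⇾ v → ψ u ≡ ψ u′ → u ≡ u′
    in-injective _ _ uv u′v = in-determined-by-src uv u′v ∘ cong src

    code : ∀ u → v ⇾ u ⊎ u ⇾ v → Fin 2 × Fin p
    code u (inj₁ vu) = suc zero , punchOut₂ (out-fresh vu)
    code u (inj₂ uv) = zero , punchOut₂ (in-fresh uv)

    code-injective : ∀ {u u′} s s′ → code u s ≡ code u′ s′ → u ≡ u′
    code-injective (inj₁ vu) (inj₁ vu′) e =
      out-determined-by-dst vu vu′ (punchOut₂-injective (out-fresh vu) (out-fresh vu′) (cong proj₂ e))
    code-injective (inj₂ uv) (inj₂ u′v) e =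
      in-determined-by-src uv u′v (punchOut₂-injective (in-fresh uv) (in-fresh u′v) (cong proj₂ e))
    code-injective (inj₁ _) (inj₂ _) ()
    code-injective (inj₂ _) (inj₁ _) ()

    code-nbr : N G v → Fin 2 × Fin p
    code-nbr (u , v~u) = code u (adj⇒arc O v u v~u)

    code-nbr-injective : Injective _≡_ _≡_ code-nbr
    code-nbr-injective {u , v~u} {u′ , v~u′} e with refl ← code-injective _ _ e =
      cong (u ,_) (T-irrelevant v~u v~u′)

    in-code-realised : ∀ {u} s {y} (y-fresh : y ≢ i × y ≢ j) →
                       code u s ≡ (zero , punchOut₂ y-fresh) → u ⇾ v × src (ψ u) ≡ y
    in-code-realised (inj₂ uv) y-fresh e =
      uv , punchOut₂-injective (in-fresh uv) y-fresh (cong proj₂ e)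

    in-surjective : ∀ y → T (LArc p y (ψ v)) → Σ (Fin n) λ u → u ⇾ v × ψ u ≡ y
    in-surjective y yv
      with y-fresh ← LArc-src-fresh y (ψ v) yv
      with (u , v~u) , e ← injective⇒surjective (regular v) (↔-sym *↔×)
                             code-nbr code-nbr-injective (zero , punchOut₂ y-fresh)
      with uv , su≡sy ← in-code-realised (adj⇒arc O v u v~u) y-fresh e
      = u , uv , LV-≡ su≡sy (trans (⇾⇒dst≡src uv) (sym (proj₁ (LArc⇒ y (ψ v) yv))))

    in-bijective : NbhdBij (flip′ (arc O)) (flip′ (LArc p)) ψ v
    in-bijective = (λ _ → hom) , in-injective , in-surjective

    undirected-bijective : NbhdBij (adj G) (LAdj p) ψ v
    undirected-bijective = homomorphic , injective , surjective
      where
        homomorphic : ∀ u → T (adj G v u) → T (LAdj p (ψ v) (ψ u))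
        homomorphic u v~u with adj⇒arc O v u v~u
        ... | inj₁ vu = Equivalence.from T-∨ (inj₁ (hom vu))
        ... | inj₂ uv = Equivalence.from T-∨ (inj₂ (hom uv))

        in≢out : ∀ {x y} → x ≡ y → T (LArc p y (ψ v)) → ¬ T (LArc p (ψ v) x)
        in≢out {y = y} refl = LArc-asym y (ψ v)

        injective : ∀ u w → T (adj G v u) → T (adj G v w) → ψ u ≡ ψ w → u ≡ w
        injective u w v~u v~w ψu≡ψw with adj⇒arc O v u v~u | adj⇒arc O v w v~w
        ... | inj₁ vu | inj₁ vw = out-injective vu vw ψu≡ψw
        ... | inj₂ uv | inj₂ wv = in-injective u w uv wv ψu≡ψw
        ... | inj₁ vu | inj₂ wv = contradiction (hom vu) (in≢out ψu≡ψw (hom wv))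
        ... | inj₂ uv | inj₁ vw = contradiction (hom vw) (in≢out (sym ψu≡ψw) (hom uv))

        surjective : ∀ y → T (LAdj p (ψ v) y) → Σ (Fin n) λ u → T (adj G v u) × ψ u ≡ y
        surjective y v~y with Equivalence.to T-∨ v~y
        ... | inj₁ vy with u , vu , ψu≡y ← out-surjective y vy =
          u , arc⇒adj O v u vu , ψu≡y
        ... | inj₂ yv with u , uv , ψu≡y ← in-surjective y yv =
          u , adj-sym G u v (arc⇒adj O u v uv) , ψu≡y

theorem12 : (p : ℕ) → 2 ≤ p → (n : ℕ) → (G : Graph n) →
    K1-Free (p + 1) G → Regular (2 * p) G →
    (O : Orientation G) → (ψ : Fin n → LV p) →
    OutNbhdBijective (arc O) (LArc p) ψ →
    LocBijOriented (arc O) (LArc p) ψ × LocBijUndirected (adj G) (LAdj p) ψ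
-- The argument does not use the bound 2 ≤ p.
theorem12 p _ n G free regular O ψ ψ-out =
  (λ v → in-bijective v , ψ-out v) , undirected-bijective
  where
    open LocallyBijective p n G free regular O ψ ψ-out
    open AtVertex
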